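{- Let $G$ be a unicyclic graph, different from a cycle, whose unique cycle $C_t$ has $t\ge 3$ vertices. If $|\tau(G)|\ge 2$, then $|\tau(G)|\le pd_s(G)\le |\tau(G)|+2$.
   Context: Graphs are finite, simple, connected; $d_G$ is shortest-path distance, $d_G(x,W)=\min\{d_G(x,w):w\in W\}$. A set $W$ strongly resolves different vertices $x,y\notin W$ if $d_G(x,W)=d_G(x,y)+d_G(y,W)$ or $d_G(y,W)=d_G(y,x)+d_G(x,W)$. A vertex partition $\Pi$ is a strong resolving partition if every two different vertices in the same set of $\Pi$ are strongly resolved by some set of $\Pi$; $pd_s(G)$ is the minimum cardinality of such a partition. $\tau(G)$ denotes the set of end-vertices (vertices of degree one) of $G$. -}

module Defs where

open import Data.Nat using (ℕ; zero; suc; _+_; _≤_; _⊓_; _≡ᵇ_; _<?_)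
open import Data.Fin using (Fin; zero; suc; toℕ; fromℕ<)
open import Data.Fin.Properties using () renaming (_≟_ to _≟F_)
open import Data.Bool using (Bool; true; false; _∧_; _∨_; if_then_else_)
open import Data.Bool.Properties using () renaming (_≟_ to _≟B_)
open import Data.List using (List; allFin; foldr; filter; length)
open import Data.Bool.ListAction using (any)
open import Data.Product using (Σ; ∃; _×_; _,_)
open import Data.Sum using (_⊎_)
open import Relation.Nullary using (¬_; does; yes; no)
open import Relation.Binary.PropositionalEquality using (_≡_; _≢_)
open import Function.Definitions using (Injective; Surjective)
open import Function.Bundles using (_⇔_)

record Graph (n : ℕ) : Set where
  field
    adj    : Fin n → Fin n → Bool
    sym    : ∀ x y → adj x y ≡ adj y x
    irrefl : ∀ x → adj x x ≡ false
open Graph public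

next : {t : ℕ} → Fin t → Fin t
next {suc t} i with suc (toℕ i) <? suc t
... | yes p = fromℕ< p
... | no _  = zero

module _ {n : ℕ} (G : Graph n) where

  -- reach k x y = true  iff  there is a walk from x to y with at most k edges
  reach : ℕ → Fin n → Fin n → Bool
  reach zero    x y = does (x ≟F y)
  reach (suc k) x y = reach k x y ∨ any (λ z → reach k x z ∧ adj G z y) (allFin n)

  Connected : Set
  Connected = ∀ x y → reach n x y ≡ true

  -- shortest-path distance d_G(x,y): the least k with reach k x y
  -- (in a connected graph every pair is reached within n steps, so the
  -- fallback value is never used)
  distFrom : ℕ → ℕ → Fin n → Fin n → ℕ
  distFrom k zero    x y = k
  distFrom k (suc f) x y = if reach k x y then k else distFrom (suc k) f x y

  dist : Fin n → Fin n → ℕ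
  dist x y = distFrom 0 (suc n) x y

  deg : Fin n → ℕ
  deg v = length (filter (λ w → adj G v w ≟B true) (allFin n))

  numEndVertices : ℕ
  numEndVertices = length (filter (λ v → (deg v ≡ᵇ 1) ≟B true) (allFin n))

  -- d(x, W) = min { d(x,w) : w ∈ W }, W ⊆ V given as a Boolean predicate
  -- (only used for nonempty W)
  distSet : Fin n → (Fin n → Bool) → ℕ
  distSet x W = foldr (λ w acc → if W w then dist x w ⊓ acc else acc) n (allFin n)

  StronglyResolves : (Fin n → Bool) → Fin n → Fin n → Set
  StronglyResolves W x y =
    W x ≡ false × W y ≡ false ×
    ( distSet x W ≡ dist x y + distSet y W
    ⊎ distSet y W ≡ dist y x + distSet x W )

  -- A partition of V into k nonempty classes, given by a surjective class map
  -- c; class i is { v | c v ≡ i }.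
  classOf : {k : ℕ} → (Fin n → Fin k) → Fin k → Fin n → Bool
  classOf c i v = does (c v ≟F i)

  IsStrongResolvingPartition : (k : ℕ) → (Fin n → Fin k) → Set
  IsStrongResolvingPartition k c =
    Surjective _≡_ _≡_ c ×
    (∀ x y → x ≢ y → c x ≡ c y →
       ∃ λ (j : Fin k) → StronglyResolves (classOf c j) x y)

  record Cycle : Set where
    field
      len     : ℕ
      len≥3   : 3 ≤ len
      vtx     : Fin len → Fin n
      inj     : Injective _≡_ _≡_ vtx
      edges   : ∀ i → adj G (vtx i) (vtx (next i)) ≡ true

  CycleEdge : Cycle → Fin n → Fin n → Set
  CycleEdge C x y = ∃ λ i →
      (Cycle.vtx C i ≡ x × Cycle.vtx C (next i) ≡ y)
    ⊎ (Cycle.vtx C i ≡ y × Cycle.vtx C (next i) ≡ x)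

  -- Unicyclic: connected, with exactly one cycle (cycles as subgraphs,
  -- i.e. identified by their edge sets).
  Unicyclic : Set
  Unicyclic = Connected × Σ Cycle λ C →
    ∀ (C' : Cycle) → ∀ x y → CycleEdge C x y ⇔ CycleEdge C' x y

  IsCycleGraph : Set
  IsCycleGraph = Σ Cycle λ C →
    Surjective _≡_ _≡_ (Cycle.vtx C) × (∀ x y → adj G x y ≡ true → CycleEdge C x y)

module Submission where

-- Lower bound.  If v is an end-vertex with neighbour p and u ≠ v, then
-- d(u,p) < d(u,v) and, for every nonempty W ∌ v, d(p,W) < d(v,W); hence
-- d(u,W) = d(u,v) + d(v,W) is impossible, i.e. no set strongly resolves a
-- pair containing an end-vertex "through" it.  Consequently two distinct
-- end-vertices never share a class, and a pigeonhole count gives τ ≤ k.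
--
-- Upper bound.  Root a breadth-first spanning tree at an end-vertex r.  Put
-- r in a class of its own and every other vertex v in the class of the tree
-- leaf reached by descending from v.  Two vertices of one class lie on a
-- common root path, so one of them lies on a geodesic from the other to r,
-- and the class {r} strongly resolves them.  A tree leaf of degree ≥ 2
-- carries a non-tree edge; every non-tree edge closes a cycle, so in a
-- unicyclic graph there is exactly one non-tree edge {a,b}.  Hence every
-- tree leaf is an end-vertex other than r, or a, or b, and the partition has
-- at most (τ - 1) + 2 + 1 = τ + 2 classes.

open import Defs hiding (sym)
open import Data.Nat using (ℕ; zero; suc; _+_; _≤_; _<_; z≤n; s≤s; _∸_; _⊓_; pred; _≡ᵇ_; _≤?_; _<?_)
open import Data.Nat.Properties
open import Data.Fin using (Fin; zero; suc; toℕ; fromℕ)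
open import Data.Fin.Properties using (any?; injective⇒≤; toℕ-fromℕ<; toℕ-injective; toℕ<n; toℕ-fromℕ) renaming (_≟_ to _≟F_; suc-injective to fsuc-injective)
open import Data.Bool using (Bool; true; false; _∧_; _∨_; T; if_then_else_)
open import Data.Bool.Properties using () renaming (_≟_ to _≟B_)
open import Data.Bool.ListAction using (any)
open import Data.List using (List; []; _∷_; length; filter; lookup; allFin; foldr)
open import Data.List.Properties using (filter-accept; filter-none; filter-some; filter-≐)
import Data.List.Relation.Unary.All as All
open import Data.List.Relation.Unary.Any as Any using (here; there; index)
open import Data.List.Relation.Unary.Any.Properties using (lookup-index)
open import Data.List.Relation.Unary.AllPairs using (_∷_)
open import Data.List.Relation.Unary.Unique.Propositional using (Unique)
open import Data.List.Relation.Unary.Unique.Propositional.Properties using (allFin⁺; filter⁺)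
open import Data.List.Membership.Propositional using (_∈_)
open import Data.List.Membership.Propositional.Properties using (∈-allFin; ∈-filter⁺; ∈-filter⁻; ∈-lookup)
open import Data.Product using (∃; _×_; _,_; proj₁; proj₂)
open import Data.Sum using (_⊎_; inj₁; inj₂)
import Data.Sum as Sum
open import Data.Empty using (⊥; ⊥-elim)
open import Data.Unit using (tt)
open import Relation.Nullary using (¬_; Dec; yes; no; does)
open import Relation.Nullary.Decidable using (_×-dec_; _⊎-dec_; ¬?; dec-true; dec-false)
open import Relation.Unary using (Pred; Decidable)
open import Relation.Binary.PropositionalEquality
open import Function.Bundles using (Equivalence)
open import Agda.Primitive using (lzero)

∨-true-elim : ∀ {a b} → a ∨ b ≡ true → a ≡ true ⊎ b ≡ true
∨-true-elim {true}  _ = inj₁ refl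
∨-true-elim {false} e = inj₂ e

∨-trueˡ : ∀ {a} b → a ≡ true → a ∨ b ≡ true
∨-trueˡ b refl = refl

∨-trueʳ : ∀ a {b} → b ≡ true → a ∨ b ≡ true
∨-trueʳ true  _ = refl
∨-trueʳ false e = e

∧-true-elim : ∀ {a b} → a ∧ b ≡ true → a ≡ true × b ≡ true
∧-true-elim {true} {true} _ = refl , refl

∧-true-intro : ∀ {a b} → a ≡ true → b ≡ true → a ∧ b ≡ true
∧-true-intro refl refl = refl

true≢false : true ≢ false
true≢false ()

≟-sound : ∀ {m} (x y : Fin m) → does (x ≟F y) ≡ true → x ≡ y
≟-sound x y e with x ≟F y
... | yes x≡y = x≡y

module _ {A : Set} (p : A → Bool) where
  any-witness : ∀ xs → any p xs ≡ true → ∃ λ x → p x ≡ true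
  any-witness (x ∷ xs) e with ∨-true-elim {p x} e
  ... | inj₁ px = x , px
  ... | inj₂ rest = any-witness xs rest

  any-intro : ∀ {x} xs → x ∈ xs → p x ≡ true → any p xs ≡ true
  any-intro (y ∷ xs) (here refl) px = ∨-trueˡ _ px
  any-intro (y ∷ xs) (there x∈xs) px = ∨-trueʳ (p y) (any-intro xs x∈xs px)

-- Well-ordering of ℕ for a decidable predicate holding at m: a least
-- witness exists.  (Abstract, so that the chosen witness is never unfolded.)
abstract
  least-witness : (P : ℕ → Set) → (∀ i → Dec (P i)) → ∀ m → P m →
    ∃ λ i → P i × i ≤ m × (∀ j → j < i → ¬ P j)
  least-witness P P? m pm = search 0 m refl (λ _ ())
    where
    search : ∀ i f → i + f ≡ m → (∀ j → j < i → ¬ P j) →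
      ∃ λ i → P i × i ≤ m × (∀ j → j < i → ¬ P j)
    search i f i+f≡m below with P? i
    ... | yes pi = i , pi , ≤-trans (m≤m+n i f) (≤-reflexive i+f≡m) , below
    search i zero i+0≡m below | no ¬pi = ⊥-elim (¬pi (subst P (trans (sym i+0≡m) (+-identityʳ i)) pm))
    search i (suc f) i+f≡m below | no ¬pi = search (suc i) f (trans (sym (+-suc i f)) i+f≡m) below′
      where
      below′ : ∀ j → j < suc i → ¬ P j
      below′ j j<1+i with j ≟ i
      ... | yes refl = ¬pi
      ... | no j≢i = below j (≤∧≢⇒< (m<1+n⇒m≤n j<1+i) j≢i)

module _ {A : Set} where
  lookup-injective : ∀ {xs : List A} → Unique xs → ∀ i j → lookup xs i ≡ lookup xs j → i ≡ j
  lookup-injective (_ ∷ _) zero zero _ = refl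
  lookup-injective (x∉ ∷ _) zero (suc j) e = ⊥-elim (All.lookup x∉ (∈-lookup j) e)
  lookup-injective (x∉ ∷ _) (suc i) zero e = ⊥-elim (All.lookup x∉ (∈-lookup i) (sym e))
  lookup-injective (_ ∷ u) (suc i) (suc j) e = cong suc (lookup-injective u i j e)

  unique-length≤ : ∀ {k} (xs : List A) → Unique xs → (f : A → Fin k) →
    (∀ {x y} → x ∈ xs → y ∈ xs → f x ≡ f y → x ≡ y) → length xs ≤ k
  unique-length≤ xs u f f-inj =
    injective⇒≤ (λ {i} {j} e → lookup-injective u i j (f-inj (∈-lookup i) (∈-lookup j) e))

module _ {A : Set} {P : Pred A lzero} (P? : Decidable P) where
  filter-length-cons : ∀ x xs → length (filter P? xs) ≤ length (filter P? (x ∷ xs))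
  filter-length-cons x xs with does (P? x)
  ... | true  = n≤1+n _
  ... | false = ≤-refl

  filter-nonempty : ∀ xs → 1 ≤ length (filter P? xs) → ∃ P
  filter-nonempty (x ∷ xs) nonempty with P? x
  ... | yes px = x , px
  ... | no _ = filter-nonempty xs nonempty

module _ {A : Set} {P Q R : Pred A lzero} (P? : Decidable P) (Q? : Decidable Q) (R? : Decidable R) where
  filter-cover : (∀ {x} → P x → Q x ⊎ R x) → ∀ xs →
    length (filter P? xs) ≤ length (filter Q? xs) + length (filter R? xs)
  filter-cover cover [] = z≤n
  filter-cover cover (x ∷ xs) with P? x
  ... | no _ = ≤-trans (filter-cover cover xs)
                 (+-mono-≤ (filter-length-cons Q? x xs) (filter-length-cons R? x xs))
  ... | yes px with cover px
  ...   | inj₁ qx rewrite filter-accept Q? {xs = xs} qx =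
            s≤s (≤-trans (filter-cover cover xs) (+-monoʳ-≤ _ (filter-length-cons R? x xs)))
  ...   | inj₂ rx rewrite filter-accept R? {xs = xs} rx =
            ≤-trans (s≤s (≤-trans (filter-cover cover xs) (+-monoˡ-≤ _ (filter-length-cons Q? x xs))))
                    (≤-reflexive (sym (+-suc _ _)))

  filter-disjoint : (∀ {x} → P x → Q x) → (∀ {x} → R x → Q x) → (∀ {x} → P x → ¬ R x) → ∀ xs →
    length (filter P? xs) + length (filter R? xs) ≤ length (filter Q? xs)
  filter-disjoint P⊆Q R⊆Q P∩R=∅ [] = z≤n
  filter-disjoint P⊆Q R⊆Q P∩R=∅ (x ∷ xs) with P? x | R? x
  ... | yes px | yes rx = ⊥-elim (P∩R=∅ px rx)
  ... | yes px | no _ rewrite filter-accept Q? {xs = xs} (P⊆Q px) =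
          s≤s (filter-disjoint P⊆Q R⊆Q P∩R=∅ xs)
  ... | no _ | yes rx rewrite filter-accept Q? {xs = xs} (R⊆Q rx) =
          ≤-trans (≤-reflexive (+-suc _ _)) (s≤s (filter-disjoint P⊆Q R⊆Q P∩R=∅ xs))
  ... | no _ | no _ = ≤-trans (filter-disjoint P⊆Q R⊆Q P∩R=∅ xs) (filter-length-cons Q? x xs)

module _ {m : ℕ} where
  count-unique : ∀ (a : Fin m) xs → Unique xs → length (filter (_≟F a) xs) ≤ 1
  count-unique a [] _ = z≤n
  count-unique a (x ∷ xs) (x∉ ∷ u) with x ≟F a
  ... | no _ = count-unique a xs u
  ... | yes refl = s≤s (≤-reflexive (cong length
          (filter-none (_≟F x) (All.map (λ x≢y y≡x → x≢y (sym y≡x)) x∉))))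

  count-allFin : ∀ (a : Fin m) → 1 ≤ length (filter (_≟F a) (allFin m))
  count-allFin a = filter-some (_≟F a) (Any.map sym (∈-allFin a))

-- Walks.  `Walk≤ k x y` says that some walk from x to y has at most k
-- edges; it wraps the Boolean `reach G k x y` so that the type checker does
-- not unfold the search hidden in `reach`.
module Walks {n : ℕ} (G : Graph n) where
  data Walk≤ (k : ℕ) (x y : Fin n) : Set where
    walk : reach G k x y ≡ true → Walk≤ k x y

  walk-suc : ∀ {k x y} → Walk≤ k x y → Walk≤ (suc k) x y
  walk-suc (walk w) = walk (∨-trueˡ _ w)

  walk-refl : ∀ x → Walk≤ 0 x x
  walk-refl x = walk (dec-true (x ≟F x) refl)

  walk-zero : ∀ {x y} → Walk≤ 0 x y → x ≡ y
  walk-zero {x} {y} (walk w) = ≟-sound x y w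

  walk-snoc : ∀ {k x z y} → Walk≤ k x z → adj G z y ≡ true → Walk≤ (suc k) x y
  walk-snoc {k} {x} {z} {y} (walk w) zy =
    walk (∨-trueʳ (reach G k x y)
      (any-intro (λ v → reach G k x v ∧ adj G v y) (allFin n) (∈-allFin z) (∧-true-intro w zy)))

  walk-last : ∀ {k x y} → Walk≤ (suc k) x y →
    Walk≤ k x y ⊎ ∃ λ z → Walk≤ k x z × adj G z y ≡ true
  walk-last {k} {x} {y} (walk w) with ∨-true-elim {reach G k x y} w
  ... | inj₁ short = inj₁ (walk short)
  ... | inj₂ ends with any-witness (λ v → reach G k x v ∧ adj G v y) (allFin n) ends
  ...   | z , wz = inj₂ (z , walk (proj₁ (∧-true-elim wz)) , proj₂ (∧-true-elim {reach G k x z} wz))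

  walk-trans : ∀ {a b x y z} → Walk≤ a x y → Walk≤ b y z → Walk≤ (a + b) x z
  walk-trans {a} {zero} {x} p q with walk-zero q
  ... | refl = subst (λ m → Walk≤ m x _) (sym (+-identityʳ a)) p
  walk-trans {a} {suc b} {x} {y} {z} p q =
    subst (λ m → Walk≤ m x z) (sym (+-suc a b)) (extend (walk-last q))
    where
    extend : Walk≤ b y z ⊎ ∃ (λ v → Walk≤ b y v × adj G v z ≡ true) → Walk≤ (suc (a + b)) x z
    extend (inj₁ q′) = walk-suc (walk-trans p q′)
    extend (inj₂ (v , q′ , vz)) = walk-snoc (walk-trans p q′) vz

  walk-sym : ∀ {k x y} → Walk≤ k x y → Walk≤ k y x
  walk-sym {zero} p with walk-zero p
  ... | refl = p
  walk-sym {suc k} {x} {y} p with walk-last p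
  ... | inj₁ q = walk-suc (walk-sym q)
  ... | inj₂ (z , q , zy) =
    walk-trans {1} {k} (walk-snoc (walk-refl y) (trans (Graph.sym G y z) zy)) (walk-sym q)

  distFrom-≤ : ∀ {j x y} k f → Walk≤ j x y → k ≤ j → distFrom G k f x y ≤ j
  distFrom-≤ k zero _ k≤j = k≤j
  distFrom-≤ {j} {x} {y} k (suc f) (walk w) k≤j with reach G k x y in found
  ... | true = k≤j
  ... | false with k ≟ j
  ...   | yes refl = ⊥-elim (true≢false (trans (sym w) found))
  ...   | no k≢j = distFrom-≤ (suc k) f (walk w) (≤∧≢⇒< k≤j k≢j)

  distFrom-walk : ∀ {x y} k f → Walk≤ (k + f) x y → Walk≤ (distFrom G k f x y) x y
  distFrom-walk {x} {y} k zero p = subst (λ m → Walk≤ m x y) (+-identityʳ k) p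
  distFrom-walk {x} {y} k (suc f) p with reach G k x y in found
  ... | true = walk found
  ... | false = distFrom-walk (suc k) f (subst (λ m → Walk≤ m x y) (+-suc k f) p)

  dist-≤-walk : ∀ {j x y} → Walk≤ j x y → dist G x y ≤ j
  dist-≤-walk p = distFrom-≤ 0 (suc n) p z≤n

module Metric {n : ℕ} (G : Graph n) (conn : Connected G) where
  open Walks G public

  d : Fin n → Fin n → ℕ
  d = dist G

  dist-walk : ∀ x y → Walk≤ (d x y) x y
  dist-walk x y = distFrom-walk 0 (suc n) (walk-suc (walk (conn x y)))

  dist-≤-n : ∀ x y → d x y ≤ n
  dist-≤-n x y = dist-≤-walk (walk (conn x y))

  dist-refl : ∀ x → d x x ≡ 0
  dist-refl x = n≤0⇒n≡0 (dist-≤-walk (walk-refl x))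

  dist-zero : ∀ {x y} → d x y ≡ 0 → x ≡ y
  dist-zero {x} {y} e = walk-zero (subst (λ m → Walk≤ m x y) e (dist-walk x y))

  dist-triangle : ∀ x y z → d x z ≤ d x y + d y z
  dist-triangle x y z = dist-≤-walk (walk-trans (dist-walk x y) (dist-walk y z))

  dist-sym : ∀ x y → d x y ≡ d y x
  dist-sym x y = ≤-antisym (dist-≤-walk (walk-sym (dist-walk y x))) (dist-≤-walk (walk-sym (dist-walk x y)))

  dist-adj : ∀ {x y} → adj G x y ≡ true → d x y ≤ 1
  dist-adj {x} xy = dist-≤-walk (walk-snoc (walk-refl x) xy)

  module _ (W : Fin n → Bool) where
    private
      step : Fin n → Fin n → ℕ → ℕ
      step x w acc = if W w then d x w ⊓ acc else acc

      fold-≤ : ∀ x w vs → w ∈ vs → W w ≡ true → foldr (step x) n vs ≤ d x w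
      fold-≤ x w (v ∷ vs) (here refl) w∈W rewrite w∈W = m⊓n≤m (d x w) _
      fold-≤ x w (v ∷ vs) (there w∈vs) w∈W with W v
      ... | true  = ≤-trans (m⊓n≤n (d x v) _) (fold-≤ x w vs w∈vs w∈W)
      ... | false = fold-≤ x w vs w∈vs w∈W

      fold-attained : ∀ x vs → foldr (step x) n vs ≡ n ⊎ ∃ λ w → W w ≡ true × foldr (step x) n vs ≡ d x w
      fold-attained x [] = inj₁ refl
      fold-attained x (v ∷ vs) with W v in v∈W
      ... | false = fold-attained x vs
      ... | true with ⊓-sel (d x v) (foldr (step x) n vs)
      ...   | inj₁ here′ = inj₂ (v , v∈W , here′)
      ...   | inj₂ rest rewrite rest = fold-attained x vs

    distSet-≤ : ∀ x w → W w ≡ true → distSet G x W ≤ d x w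
    distSet-≤ x w w∈W = fold-≤ x w (allFin n) (∈-allFin w) w∈W

    distSet-attained : ∀ x w₀ → W w₀ ≡ true → ∃ λ w → W w ≡ true × distSet G x W ≡ d x w
    distSet-attained x w₀ w₀∈W with fold-attained x (allFin n)
    ... | inj₂ attained = attained
    ... | inj₁ isn = w₀ , w₀∈W , ≤-antisym (distSet-≤ x w₀ w₀∈W) (subst (d x w₀ ≤_) (sym isn) (dist-≤-n x w₀))

    distSet-triangle : ∀ x y w₀ → W w₀ ≡ true → distSet G x W ≤ d x y + distSet G y W
    distSet-triangle x y w₀ w₀∈W with distSet-attained y w₀ w₀∈W
    ... | w , w∈W , dyW rewrite dyW = ≤-trans (distSet-≤ x w w∈W) (dist-triangle x y w)

module Degrees {n : ℕ} (G : Graph n) where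
  EndVertex : Fin n → Set
  EndVertex v = (deg G v ≡ᵇ 1) ≡ true

  endVertex? : Decidable EndVertex
  endVertex? v = (deg G v ≡ᵇ 1) ≟B true

  adj? : (v w : Fin n) → Dec (adj G v w ≡ true)
  adj? v w = adj G v w ≟B true

  private
    T-true : ∀ {b} → b ≡ true → T b
    T-true refl = tt

  end-neighbour : ∀ v → EndVertex v → ∃ λ p → adj G v p ≡ true × (∀ w → adj G v w ≡ true → w ≡ p)
  end-neighbour v deg≡1 = single (filter (adj? v) (allFin n)) refl (≡ᵇ⇒≡ (deg G v) 1 (T-true deg≡1))
    where
    single : ∀ ws → ws ≡ filter (adj? v) (allFin n) → length ws ≡ 1 →
      ∃ λ p → adj G v p ≡ true × (∀ w → adj G v w ≡ true → w ≡ p)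
    single (p ∷ []) ws≡ _ = p , proj₂ (∈-filter⁻ (adj? v) {xs = allFin n} (subst (p ∈_) ws≡ (here refl))) , only-p
      where
      only-p : ∀ w → adj G v w ≡ true → w ≡ p
      only-p w vw with subst (w ∈_) (sym ws≡) (∈-filter⁺ (adj? v) (∈-allFin w) vw)
      ... | here w≡p = w≡p

  end-vertex-intro : ∀ v p → adj G v p ≡ true → (∀ w → adj G v w ≡ true → w ≡ p) → EndVertex v
  end-vertex-intro v p vp only-p = subst (λ m → (m ≡ᵇ 1) ≡ true) (sym deg≡1) refl
    where
    deg≡1 : deg G v ≡ 1
    deg≡1 = trans (cong length (filter-≐ (adj? v) (_≟F p) ((λ {w} → only-p w) , λ { refl → vp }) (allFin n)))
                  (≤-antisym (count-unique p (allFin n) (allFin⁺ n)) (count-allFin p))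

module LowerBound {n : ℕ} (G : Graph n) (conn : Connected G) where
  open Metric G conn
  open Degrees G

  module _ {v p : Fin n} (only-p : ∀ w → adj G v w ≡ true → w ≡ p) where
    walk-via-neighbour : ∀ k u → u ≢ v → Walk≤ (suc k) u v → Walk≤ k u p
    walk-via-neighbour k u u≢v q = via k (walk-last q)
      where
      via : ∀ k → Walk≤ k u v ⊎ (∃ λ w → Walk≤ k u w × adj G w v ≡ true) → Walk≤ k u p
      via k (inj₂ (w , q′ , wv)) = subst (Walk≤ k u) (only-p w (trans (Graph.sym G v w) wv)) q′
      via zero (inj₁ q′) = ⊥-elim (u≢v (walk-zero q′))
      via (suc k) (inj₁ q′) = walk-suc (walk-via-neighbour k u u≢v q′)

    dist-via-neighbour : ∀ u → u ≢ v → suc (d u p) ≤ d u v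
    dist-via-neighbour u u≢v = bound (d u v) (dist-walk u v)
      where
      bound : ∀ m → Walk≤ m u v → suc (d u p) ≤ m
      bound zero q = ⊥-elim (u≢v (walk-zero q))
      bound (suc m) q = s≤s (dist-≤-walk (walk-via-neighbour m u u≢v q))

  -- For the
  -- neighbour p of v both d(u,p) < d(u,v) and d(p,W) < d(v,W).
  end-vertex-not-between : ∀ W w₀ → W w₀ ≡ true → ∀ u v → u ≢ v → EndVertex v → W v ≡ false →
    distSet G u W ≢ d u v + distSet G v W
  end-vertex-not-between W w₀ w₀∈W u v u≢v end-v v∉W between
    with end-neighbour v end-v
  ... | p , _ , only-p with distSet-attained W v w₀ w₀∈W
  ...   | w , w∈W , dvW≡dvw = <-irrefl refl (begin-strict
          distSet G u W              ≤⟨ distSet-triangle W u p w₀ w₀∈W ⟩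
          d u p + distSet G p W      <⟨ +-mono-< (dist-via-neighbour only-p u u≢v) p-closer ⟩
          d u v + distSet G v W      ≡⟨ sym between ⟩
          distSet G u W              ∎)
    where
    open ≤-Reasoning
    w≢v : w ≢ v
    w≢v refl = true≢false (trans (sym w∈W) v∉W)
    p-closer : distSet G p W < distSet G v W
    p-closer = begin-strict
      distSet G p W  ≤⟨ distSet-≤ W p w w∈W ⟩
      d p w          ≡⟨ dist-sym p w ⟩
      d w p          <⟨ dist-via-neighbour only-p w w≢v ⟩
      d w v          ≡⟨ dist-sym w v ⟩
      d v w          ≡⟨ sym dvW≡dvw ⟩
      distSet G v W  ∎

  class-nonempty : ∀ {k} (c : Fin n → Fin k) → IsStrongResolvingPartition G k c →
    ∀ j → ∃ λ w → classOf G c j w ≡ true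
  class-nonempty c (surj , _) j = proj₁ (surj j) , dec-true (c (proj₁ (surj j)) ≟F j) (proj₂ (surj j) refl)

  end-vertices-separated : ∀ k c → IsStrongResolvingPartition G k c →
    ∀ {x y} → EndVertex x → EndVertex y → c x ≡ c y → x ≡ y
  end-vertices-separated k c srp {x} {y} end-x end-y cx≡cy with x ≟F y
  ... | yes x≡y = x≡y
  ... | no x≢y with proj₂ srp x y x≢y cx≡cy
  ...   | j , x∉W , y∉W , resolved with class-nonempty c srp j
  ...     | w₀ , w₀∈W with resolved
  ...       | inj₁ y-between = ⊥-elim (end-vertex-not-between (classOf G c j) w₀ w₀∈W x y x≢y end-y y∉W y-between)
  ...       | inj₂ x-between = ⊥-elim (end-vertex-not-between (classOf G c j) w₀ w₀∈W y x (λ y≡x → x≢y (sym y≡x)) end-x x∉W x-between)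

  lower-bound : ∀ k c → IsStrongResolvingPartition G k c → numEndVertices G ≤ k
  lower-bound k c srp =
    unique-length≤ (filter endVertex? (allFin n)) (filter⁺ endVertex? (allFin⁺ n)) c
      (λ x∈ y∈ → end-vertices-separated k c srp (end x∈) (end y∈))
    where
    end : ∀ {x} → x ∈ filter endVertex? (allFin n) → EndVertex x
    end x∈ = proj₂ (∈-filter⁻ endVertex? {xs = allFin n} x∈)

-- The breadth-first spanning tree rooted at r: the parent of x ≠ r is a
-- neighbour one step closer to r (chosen by search), the parent of r is r.
module BFSTree {n : ℕ} (G : Graph n) (conn : Connected G) (r : Fin n) where
  open Metric G conn public

  depth : Fin n → ℕ
  depth x = d r x

  depth-zero : ∀ {x} → depth x ≡ 0 → x ≡ r
  depth-zero e = sym (dist-zero e)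

  depth-root : depth r ≡ 0
  depth-root = dist-refl r

  IsParent : Fin n → Fin n → Set
  IsParent x p = adj G p x ≡ true × suc (depth p) ≡ depth x

  isParent? : ∀ x p → Dec (IsParent x p)
  isParent? x p = (adj G p x ≟B true) ×-dec (suc (depth p) ≟ depth x)

  -- The last edge of a shortest walk from r to x ≠ r leads from a parent.
  parent-exists : ∀ x → x ≢ r → ∃ (IsParent x)
  parent-exists x x≢r with depth x in dx
  ... | zero = ⊥-elim (x≢r (depth-zero dx))
  ... | suc m with walk-last (subst (λ k → Walk≤ k r x) dx (dist-walk r x))
  ...   | inj₁ shorter = ⊥-elim (<-irrefl refl (≤-trans (≤-reflexive (sym dx)) (dist-≤-walk shorter)))
  ...   | inj₂ (p , r→p , px) = p , px , ≤-antisym (s≤s (dist-≤-walk r→p)) farther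
    where
    open ≤-Reasoning
    farther : suc m ≤ suc (depth p)
    farther = begin
      suc m            ≡⟨ sym dx ⟩
      depth x          ≤⟨ dist-triangle r p x ⟩
      depth p + d p x  ≤⟨ +-monoʳ-≤ (depth p) (dist-adj px) ⟩
      depth p + 1      ≡⟨ +-comm (depth p) 1 ⟩
      suc (depth p)    ∎

  parent : Fin n → Fin n
  parent x with any? (isParent? x)
  ... | yes (p , _) = p
  ... | no _ = x

  parent-spec : ∀ x → x ≢ r → IsParent x (parent x)
  parent-spec x x≢r with any? (isParent? x)
  ... | yes (_ , ok) = ok
  ... | no none = ⊥-elim (none (parent-exists x x≢r))

  parent-root : parent r ≡ r
  parent-root with any? (isParent? r)
  ... | yes (p , _ , 1+dp≡0) with () ← trans 1+dp≡0 depth-root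
  parent-root | no _ = refl

  parent-adj : ∀ x → x ≢ r → adj G x (parent x) ≡ true
  parent-adj x x≢r = trans (Graph.sym G x (parent x)) (proj₁ (parent-spec x x≢r))

  parent-depth : ∀ x → x ≢ r → suc (depth (parent x)) ≡ depth x
  parent-depth x x≢r = proj₂ (parent-spec x x≢r)

  depth-parent : ∀ x → depth (parent x) ≡ pred (depth x)
  depth-parent x with x ≟F r
  ... | yes x≡r = trans (cong depth (trans (cong parent x≡r) parent-root))
                        (trans depth-root (cong pred (sym (trans (cong depth x≡r) depth-root))))
  ... | no x≢r = cong pred (parent-depth x x≢r)

  parent-step : ∀ y z → d y (parent z) + depth (parent z) ≤ d y z + depth z
  parent-step y z with z ≟F r
  ... | yes refl rewrite parent-root = ≤-refl
  ... | no z≢r = begin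
      d y (parent z) + depth (parent z)   ≤⟨ +-monoˡ-≤ _ (dist-triangle y z (parent z)) ⟩
      d y z + d z (parent z) + depth (parent z)
                                          ≤⟨ +-monoˡ-≤ _ (+-monoʳ-≤ (d y z) (dist-adj (parent-adj z z≢r))) ⟩
      d y z + 1 + depth (parent z)        ≡⟨ +-assoc (d y z) 1 _ ⟩
      d y z + suc (depth (parent z))      ≡⟨ cong (d y z +_) (parent-depth z z≢r) ⟩
      d y z + depth z                     ∎
    where open ≤-Reasoning

  ancestor : ℕ → Fin n → Fin n
  ancestor zero x = x
  ancestor (suc m) x = parent (ancestor m x)

  ancestor-+ : ∀ m k x → ancestor (m + k) x ≡ ancestor m (ancestor k x)
  ancestor-+ zero k x = refl
  ancestor-+ (suc m) k x = cong parent (ancestor-+ m k x)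

  depth-ancestor : ∀ m x → depth (ancestor m x) ≡ depth x ∸ m
  depth-ancestor zero x = refl
  depth-ancestor (suc m) x = begin
    depth (parent (ancestor m x))  ≡⟨ depth-parent (ancestor m x) ⟩
    pred (depth (ancestor m x))    ≡⟨ cong pred (depth-ancestor m x) ⟩
    pred (depth x ∸ m)             ≡⟨ pred[m∸n]≡m∸[1+n] (depth x) m ⟩
    depth x ∸ suc m                ∎
    where open ≡-Reasoning

  ancestor-root : ∀ m x → depth x ≤ m → ancestor m x ≡ r
  ancestor-root m x dx≤m = depth-zero (trans (depth-ancestor m x) (m≤n⇒m∸n≡0 dx≤m))

  ancestor-≢root : ∀ i x → i < depth x → ancestor i x ≢ r
  ancestor-≢root i x i<dx anc≡r = <⇒≢ (m<n⇒0<n∸m i<dx)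
    (sym (trans (sym (depth-ancestor i x)) (trans (cong depth anc≡r) depth-root)))

  ancestor-injective : ∀ x i i′ → i ≤ depth x → i′ ≤ depth x → ancestor i x ≡ ancestor i′ x → i ≡ i′
  ancestor-injective x i i′ i≤ i′≤ e =
    ∸-cancelˡ-≡ i≤ i′≤ (trans (sym (depth-ancestor i x)) (trans (cong depth e) (depth-ancestor i′ x)))

  ancestor-geodesic : ∀ m y → depth y ≡ d y (ancestor m y) + depth (ancestor m y)
  ancestor-geodesic m y = ≤-antisym via-ancestor (climb m)
    where
    climb : ∀ m → d y (ancestor m y) + depth (ancestor m y) ≤ depth y
    climb zero rewrite dist-refl y = ≤-refl
    climb (suc m) = ≤-trans (parent-step y (ancestor m y)) (climb m)
    via-ancestor : depth y ≤ d y (ancestor m y) + depth (ancestor m y)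
    via-ancestor = ≤-trans (dist-triangle r (ancestor m y) y)
      (≤-reflexive (trans (+-comm (depth (ancestor m y)) _) (cong (_+ depth (ancestor m y)) (dist-sym _ y))))

  IsAncestor : Fin n → Fin n → Set
  IsAncestor v b = ancestor (depth b ∸ depth v) b ≡ v

  isAncestor? : ∀ v b → Dec (IsAncestor v b)
  isAncestor? v b = ancestor (depth b ∸ depth v) b ≟F v

  ancestor-isAncestor : ∀ j b {v} → ancestor j b ≡ v → IsAncestor v b
  ancestor-isAncestor j b {v} refl with j ≤? depth b
  ... | yes j≤db = cong (λ i → ancestor i b)
          (trans (cong (depth b ∸_) (depth-ancestor j b)) (m∸[m∸n]≡n j≤db))
  ... | no j>db = begin
      ancestor (depth b ∸ depth (ancestor j b)) b  ≡⟨ cong (λ z → ancestor (depth b ∸ depth z) b) top ⟩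
      ancestor (depth b ∸ depth r) b               ≡⟨ cong (λ i → ancestor (depth b ∸ i) b) depth-root ⟩
      ancestor (depth b) b                         ≡⟨ ancestor-root (depth b) b ≤-refl ⟩
      r                                            ≡⟨ sym top ⟩
      ancestor j b                                 ∎
    where
    open ≡-Reasoning
    top : ancestor j b ≡ r
    top = ancestor-root j b (<⇒≤ (≰⇒> j>db))

  IsChild : Fin n → Fin n → Set
  IsChild x c = c ≢ r × parent c ≡ x

  isChild? : ∀ x c → Dec (IsChild x c)
  isChild? x c = ¬? (c ≟F r) ×-dec (parent c ≟F x)

  Childless : Fin n → Set
  Childless x = ¬ ∃ (IsChild x)

  descend : ℕ → Fin n → Fin n
  descend zero v = v
  descend (suc f) v with any? (isChild? v)
  ... | yes (c , _) = descend f c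
  ... | no _ = v

  descend-ancestor : ∀ f v → ∃ λ m → ancestor m (descend f v) ≡ v
  descend-ancestor zero v = 0 , refl
  descend-ancestor (suc f) v with any? (isChild? v)
  ... | no _ = 0 , refl
  ... | yes (c , _ , pc≡v) with descend-ancestor f c
  ...   | m , e = suc m , trans (cong parent e) pc≡v

  descend-depth : ∀ f v → Childless (descend f v) ⊎ depth (descend f v) ≡ f + depth v
  descend-depth zero v = inj₂ refl
  descend-depth (suc f) v with any? (isChild? v)
  ... | no none = inj₁ none
  ... | yes (c , c≢r , pc≡v) with descend-depth f c
  ...   | inj₁ stops = inj₁ stops
  ...   | inj₂ deep = inj₂ (trans deep (trans (cong (f +_) dc) (+-suc f (depth v))))
    where
    dc : depth c ≡ suc (depth v)
    dc = trans (sym (parent-depth c c≢r)) (cong (λ z → suc (depth z)) pc≡v)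

  descend-mono : ∀ f v → depth v ≤ depth (descend f v)
  descend-mono zero v = ≤-refl
  descend-mono (suc f) v with any? (isChild? v)
  ... | no _ = ≤-refl
  ... | yes (c , c≢r , pc≡v) =
    ≤-trans (≤-trans (≤-reflexive (cong depth (sym pc≡v))) (n≤1+n _))
            (≤-trans (≤-reflexive (parent-depth c c≢r)) (descend-mono f c))

  -- The tree leaf below v: depths are at most n, so n+1 steps always stop.
  treeLeaf : Fin n → Fin n
  treeLeaf v = descend (suc n) v

  treeLeaf-childless : ∀ v → Childless (treeLeaf v)
  treeLeaf-childless v with descend-depth (suc n) v
  ... | inj₁ stops = stops
  ... | inj₂ deep = ⊥-elim (<-irrefl refl (begin-strict
      n                       <⟨ s≤s (m≤m+n n (depth v)) ⟩
      suc n + depth v         ≡⟨ sym deep ⟩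
      depth (treeLeaf v)      ≤⟨ dist-≤-n r (treeLeaf v) ⟩
      n                       ∎))
    where open ≤-Reasoning

  treeLeaf-≢root : ∀ v → v ≢ r → treeLeaf v ≢ r
  treeLeaf-≢root v v≢r leaf≡r = v≢r (depth-zero (n≤0⇒n≡0
    (≤-trans (descend-mono (suc n) v) (≤-reflexive (trans (cong depth leaf≡r) depth-root)))))

  treeLeaf-self : ∀ v → Childless v → treeLeaf v ≡ v
  treeLeaf-self v childless with any? (isChild? v)
  ... | yes child = ⊥-elim (childless child)
  ... | no _ = refl

  ancestor-of-ancestor : ∀ {ℓ m m′ x y} → ancestor m ℓ ≡ x → ancestor m′ ℓ ≡ y → m ≤ m′ →
    ancestor (m′ ∸ m) x ≡ y
  ancestor-of-ancestor {ℓ} {m} {m′} refl refl m≤m′ =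
    trans (sym (ancestor-+ (m′ ∸ m) m ℓ)) (cong (λ i → ancestor i ℓ) (m∸n+n≡m m≤m′))

  -- Two vertices above the same tree leaf lie on one root path, so one of
  -- them is on a geodesic from the other to r.
  same-treeLeaf-geodesic : ∀ x y → treeLeaf x ≡ treeLeaf y →
    depth x ≡ d x y + depth y ⊎ depth y ≡ d y x + depth x
  same-treeLeaf-geodesic x y same
    with descend-ancestor (suc n) x | descend-ancestor (suc n) y
  ... | m , mx | m′ , m′y with m ≤? m′
  ...   | yes m≤m′ = inj₁ (subst (λ z → depth x ≡ d x z + depth z)
                              (ancestor-of-ancestor mx (trans (cong (ancestor m′) same) m′y) m≤m′)
                              (ancestor-geodesic (m′ ∸ m) x))
  ...   | no m≰m′ = inj₂ (subst (λ z → depth y ≡ d y z + depth z)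
                             (ancestor-of-ancestor m′y (trans (cong (ancestor m) (sym same)) mx) (<⇒≤ (≰⇒> m≰m′)))
                             (ancestor-geodesic (m ∸ m′) y))

next-toℕ : ∀ {t} (i : Fin t) →
  (suc (toℕ i) < t × toℕ (next i) ≡ suc (toℕ i)) ⊎ (suc (toℕ i) ≡ t × toℕ (next i) ≡ 0)
next-toℕ {suc t} i with suc (toℕ i) <? suc t
... | yes i+1<t = inj₁ (i+1<t , toℕ-fromℕ< i+1<t)
... | no i+1≮t = inj₂ (≤-antisym (toℕ<n i) (≮⇒≥ i+1≮t) , refl)

∸-suc-split : ∀ m k → suc k ≤ m → m ∸ k ≡ suc (m ∸ suc k)
∸-suc-split (suc m) zero _ = refl
∸-suc-split (suc m) (suc k) (s≤s k<m) = ∸-suc-split m k k<m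

module FundamentalCycle {n : ℕ} (G : Graph n) (conn : Connected G) (r : Fin n) where
  open BFSTree G conn r public
  open Degrees G public

  TreeEdge : Fin n → Fin n → Set
  TreeEdge x y = (x ≢ r × y ≡ parent x) ⊎ (y ≢ r × x ≡ parent y)

  tree-edge-sym : ∀ {x y} → TreeEdge x y → TreeEdge y x
  tree-edge-sym (inj₁ up) = inj₂ up
  tree-edge-sym (inj₂ down) = inj₁ down

  tree-edge-adj : ∀ {x y} → TreeEdge x y → adj G x y ≡ true
  tree-edge-adj {x} (inj₁ (x≢r , refl)) = parent-adj x x≢r
  tree-edge-adj {y = y} (inj₂ (y≢r , refl)) = trans (Graph.sym G (parent y) y) (parent-adj y y≢r)

  NonTreeEdge : Fin n → Fin n → Set
  NonTreeEdge a b = adj G a b ≡ true × b ≢ parent a × a ≢ parent b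

  nonTreeEdge? : ∀ a b → Dec (NonTreeEdge a b)
  nonTreeEdge? a b = adj? a b ×-dec ¬? (b ≟F parent a) ×-dec ¬? (a ≟F parent b)

  -- A childless vertex other than r is an end-vertex or carries a non-tree
  -- edge: a second neighbour z is neither its parent nor its child.
  childless-kinds : ∀ v → v ≢ r → Childless v → EndVertex v ⊎ ∃ (NonTreeEdge v)
  childless-kinds v v≢r childless with any? (λ z → adj? v z ×-dec ¬? (z ≟F parent v))
  ... | yes (z , vz , z≢pv) = inj₂ (z , vz , z≢pv , v≢pz)
    where
    v≢pz : v ≢ parent z
    v≢pz v≡pz with z ≟F r
    ... | yes refl = v≢r (trans v≡pz parent-root)
    ... | no z≢r = childless (z , z≢r , sym v≡pz)
  ... | no none = inj₁ (end-vertex-intro v (parent v) (parent-adj v v≢r) only-parent)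
    where
    only-parent : ∀ w → adj G v w ≡ true → w ≡ parent v
    only-parent w vw with w ≟F parent v
    ... | yes w≡pv = w≡pv
    ... | no w≢pv = ⊥-elim (none (w , vw , w≢pv))

  nonTree-not-tree : ∀ {a b} → NonTreeEdge a b → ¬ TreeEdge a b
  nonTree-not-tree (_ , b≢pa , _) (inj₁ (_ , b≡pa)) = b≢pa b≡pa
  nonTree-not-tree (_ , _ , a≢pb) (inj₂ (_ , a≡pb)) = a≢pb a≡pb

  -- The fundamental cycle of a non-tree edge {a,b}: with A i, B j the
  -- ancestors of a and b, and u = A α the first ancestor of a that is also
  -- an ancestor of b (u = B β), the cycle is
  --   a = A 0, A 1, …, A α = u = B β, B (β-1), …, B 0 = b.
  module CycleOf (a b : Fin n) (ab : NonTreeEdge a b) where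
    A B : ℕ → Fin n
    A i = ancestor i a
    B j = ancestor j b

    private
      -- The root, reached after depth a steps, is a common ancestor.
      meet : ∃ λ i → IsAncestor (A i) b × i ≤ depth a × (∀ j → j < i → ¬ IsAncestor (A j) b)
      meet = least-witness (λ i → IsAncestor (A i) b) (λ i → isAncestor? (A i) b) (depth a)
        (ancestor-isAncestor (depth b) b
          (trans (ancestor-root (depth b) b ≤-refl) (sym (ancestor-root (depth a) a ≤-refl))))

    α : ℕ
    α = proj₁ meet

    u : Fin n
    u = A α

    β : ℕ
    β = depth b ∸ depth u

    Bβ≡u : B β ≡ u
    Bβ≡u = proj₁ (proj₂ meet)

    α≤depth : α ≤ depth a
    α≤depth = proj₁ (proj₂ (proj₂ meet))

    α-least : ∀ i → i < α → ¬ IsAncestor (A i) b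
    α-least = proj₂ (proj₂ (proj₂ meet))

    β≤depth : β ≤ depth b
    β≤depth = m∸n≤m (depth b) (depth u)

    A≢B : ∀ i j → i ≤ α → j < β → A i ≢ B j
    A≢B i j i≤α j<β Ai≡Bj with m≤n⇒m<n∨m≡n i≤α
    ... | inj₁ i<α = α-least i i<α (ancestor-isAncestor j b (sym Ai≡Bj))
    ... | inj₂ refl = <⇒≢ j<β (ancestor-injective b j β (≤-trans (<⇒≤ j<β) β≤depth) β≤depth
                        (trans (sym Ai≡Bj) (sym Bβ≡u)))

    loop : ℕ → Fin n
    loop k with k ≤? α
    ... | yes _ = A k
    ... | no _ = B (α + β ∸ k)

    loop-A : ∀ k → k ≤ α → loop k ≡ A k
    loop-A k k≤α with k ≤? α
    ... | yes _ = refl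
    ... | no k≰α = ⊥-elim (k≰α k≤α)

    loop-B : ∀ k → α ≤ k → loop k ≡ B (α + β ∸ k)
    loop-B k α≤k with k ≤? α
    ... | no _ = refl
    ... | yes k≤α with ≤-antisym k≤α α≤k
    ...   | refl = sym (trans (cong B (m+n∸m≡n α β)) Bβ≡u)

    loop-start : loop 0 ≡ a
    loop-start = loop-A 0 z≤n

    loop-end : loop (α + β) ≡ b
    loop-end = trans (loop-B (α + β) (m≤m+n α β)) (cong B (n∸n≡0 (α + β)))

    B-index< : ∀ k → α < k → k ≤ α + β → α + β ∸ k < β
    B-index< k α<k k≤ = subst (α + β ∸ k <_) (m+n∸m≡n α β) (∸-monoʳ-< α<k k≤)

    loop-injective : ∀ k k′ → k ≤ α + β → k′ ≤ α + β → loop k ≡ loop k′ → k ≡ k′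
    loop-injective k k′ k≤ k′≤ e with k ≤? α | k′ ≤? α
    ... | yes k≤α | yes k′≤α = ancestor-injective a k k′ (≤-trans k≤α α≤depth) (≤-trans k′≤α α≤depth) e
    ... | yes k≤α | no k′≰α = ⊥-elim (A≢B k _ k≤α (B-index< k′ (≰⇒> k′≰α) k′≤) e)
    ... | no k≰α | yes k′≤α = ⊥-elim (A≢B k′ _ k′≤α (B-index< k (≰⇒> k≰α) k≤) (sym e))
    ... | no k≰α | no k′≰α =
      ∸-cancelˡ-≡ k≤ k′≤ (ancestor-injective b _ _
        (≤-trans (<⇒≤ (B-index< k (≰⇒> k≰α) k≤)) β≤depth)
        (≤-trans (<⇒≤ (B-index< k′ (≰⇒> k′≰α) k′≤)) β≤depth) e)

    loop-tree-edge : ∀ k → k < α + β → TreeEdge (loop k) (loop (suc k))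
    loop-tree-edge k k< with suc k ≤? α
    ... | yes k<α rewrite loop-A k (<⇒≤ k<α) =
          inj₁ (ancestor-≢root k a (<-≤-trans k<α α≤depth) , refl)
    ... | no k+1≰α
          rewrite loop-B k (m<1+n⇒m≤n (≰⇒> k+1≰α)) | ∸-suc-split (α + β) k k< =
          inj₂ (ancestor-≢root _ b (<-≤-trans (B-index< (suc k) (≰⇒> k+1≰α) k<) β≤depth) , refl)

    -- The cycle has at least three vertices, since a ≠ b, b ≠ parent a and
    -- a ≠ parent b.
    long : 2 ≤ α + β
    long = at-least-two α β refl refl
      where
      A≡B : ∀ {i j} → i ≡ α → j ≡ β → A i ≡ B j
      A≡B i≡α j≡β = trans (cong A i≡α) (trans (sym Bβ≡u) (cong B (sym j≡β)))
      a≢b : a ≢ b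
      a≢b refl = true≢false (trans (sym (proj₁ ab)) (Graph.irrefl G a))
      at-least-two : ∀ i j → i ≡ α → j ≡ β → 2 ≤ i + j
      at-least-two 0 0 i≡α j≡β = ⊥-elim (a≢b (A≡B i≡α j≡β))
      at-least-two 1 0 i≡α j≡β = ⊥-elim (proj₁ (proj₂ ab) (sym (A≡B i≡α j≡β)))
      at-least-two 0 1 i≡α j≡β = ⊥-elim (proj₂ (proj₂ ab) (A≡B i≡α j≡β))
      at-least-two 0 (suc (suc j)) _ _ = s≤s (s≤s z≤n)
      at-least-two 1 (suc j) _ _ = s≤s (s≤s z≤n)
      at-least-two (suc (suc i)) j _ _ = s≤s (s≤s z≤n)

    vtx : Fin (suc (α + β)) → Fin n
    vtx i = loop (toℕ i)

    cycle-step : ∀ i → TreeEdge (vtx i) (vtx (next i)) ⊎ (vtx i ≡ b × vtx (next i) ≡ a)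
    cycle-step i = by-position (next-toℕ i)
      where
      by-position : (suc (toℕ i) < suc (α + β) × toℕ (next i) ≡ suc (toℕ i))
                  ⊎ (suc (toℕ i) ≡ suc (α + β) × toℕ (next i) ≡ 0) →
                  TreeEdge (vtx i) (vtx (next i)) ⊎ (vtx i ≡ b × vtx (next i) ≡ a)
      by-position (inj₁ (i+1<t , next≡)) =
        inj₁ (subst (λ m → TreeEdge (vtx i) (loop m)) (sym next≡) (loop-tree-edge (toℕ i) (≤-pred i+1<t)))
      by-position (inj₂ (i+1≡t , next≡0)) =
        inj₂ (trans (cong loop (suc-injective i+1≡t)) loop-end , trans (cong loop next≡0) loop-start)

    cycle-step-adj : ∀ i → adj G (vtx i) (vtx (next i)) ≡ true
    cycle-step-adj i = step-adj (cycle-step i)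
      where
      step-adj : TreeEdge (vtx i) (vtx (next i)) ⊎ (vtx i ≡ b × vtx (next i) ≡ a) →
                 adj G (vtx i) (vtx (next i)) ≡ true
      step-adj (inj₁ tree) = tree-edge-adj tree
      step-adj (inj₂ (vtx≡b , next≡a)) =
        subst₂ (λ v w → adj G v w ≡ true) (sym vtx≡b) (sym next≡a) (trans (Graph.sym G b a) (proj₁ ab))

    cycle : Cycle G
    cycle = record
      { len   = suc (α + β)
      ; len≥3 = s≤s long
      ; vtx   = vtx
      ; inj   = λ {i} {j} e → toℕ-injective (loop-injective (toℕ i) (toℕ j) (≤-pred (toℕ<n i)) (≤-pred (toℕ<n j)) e)
      ; edges = cycle-step-adj
      }

    cycle-edge-kind : ∀ {x y} → CycleEdge G cycle x y → TreeEdge x y ⊎ (x ≡ a × y ≡ b) ⊎ (x ≡ b × y ≡ a)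
    cycle-edge-kind (i , orientation) = kind (cycle-step i) orientation
      where
      kind : ∀ {x y} → TreeEdge (vtx i) (vtx (next i)) ⊎ (vtx i ≡ b × vtx (next i) ≡ a) →
             (vtx i ≡ x × vtx (next i) ≡ y) ⊎ (vtx i ≡ y × vtx (next i) ≡ x) →
             TreeEdge x y ⊎ (x ≡ a × y ≡ b) ⊎ (x ≡ b × y ≡ a)
      kind (inj₁ tree) (inj₁ (refl , refl)) = inj₁ tree
      kind (inj₁ tree) (inj₂ (refl , refl)) = inj₁ (tree-edge-sym tree)
      kind (inj₂ (x≡b , y≡a)) (inj₁ (refl , refl)) = inj₂ (inj₂ (x≡b , y≡a))
      kind (inj₂ (y≡b , x≡a)) (inj₂ (refl , refl)) = inj₂ (inj₁ (x≡a , y≡b))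

    closing-edge : CycleEdge G cycle a b
    closing-edge = fromℕ (α + β) , inj₂ (trans (cong loop (toℕ-fromℕ (α + β))) loop-end , wraps (next-toℕ (fromℕ (α + β))))
      where
      wraps : (suc (toℕ (fromℕ (α + β))) < suc (α + β) × toℕ (next (fromℕ (α + β))) ≡ suc (toℕ (fromℕ (α + β))))
            ⊎ (suc (toℕ (fromℕ (α + β))) ≡ suc (α + β) × toℕ (next (fromℕ (α + β))) ≡ 0) →
            vtx (next (fromℕ (α + β))) ≡ a
      wraps (inj₁ (last+1<t , _)) = ⊥-elim (<-irrefl (cong suc (toℕ-fromℕ (α + β))) last+1<t)
      wraps (inj₂ (_ , next≡0)) = trans (cong loop next≡0) loop-start

  -- In a unicyclic graph all non-tree edges coincide: {a,b} lies on the
  -- fundamental cycle of {a,b}, hence on the unique cycle, hence on the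
  -- fundamental cycle of {x,z}, whose only non-tree edge is {x,z}.
  nonTree-unique : Unicyclic G → ∀ {a b x z} → NonTreeEdge a b → NonTreeEdge x z →
    (a ≡ x × b ≡ z) ⊎ (a ≡ z × b ≡ x)
  nonTree-unique (_ , C₀ , unique) {a} {b} {x} {z} ab xz =
    ends (CycleOf.cycle-edge-kind x z xz
           (Equivalence.to (unique (CycleOf.cycle x z xz) a b)
             (Equivalence.from (unique (CycleOf.cycle a b ab) a b) (CycleOf.closing-edge a b ab))))
    where
    ends : TreeEdge a b ⊎ (a ≡ x × b ≡ z) ⊎ (a ≡ z × b ≡ x) → (a ≡ x × b ≡ z) ⊎ (a ≡ z × b ≡ x)
    ends (inj₁ tree) = ⊥-elim (nonTree-not-tree ab tree)
    ends (inj₂ same-or-swapped) = same-or-swapped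

module UpperBound {n : ℕ} (G : Graph n) (uni : Unicyclic G) (r : Fin n) (end-r : Degrees.EndVertex G r) where
  open FundamentalCycle G (proj₁ uni) r

  -- All non-tree edges start at one of two vertices a, b (the endpoints of
  -- the unique non-tree edge; any pair if there is none).
  nonTree-ends : ∃ λ (ends : Fin n × Fin n) → ∀ {x z} → NonTreeEdge x z → x ≡ proj₁ ends ⊎ x ≡ proj₂ ends
  nonTree-ends = from-search (any? (λ a → any? (λ b → nonTreeEdge? a b)))
    where
    from-search : Dec (∃ λ a → ∃ λ b → NonTreeEdge a b) →
      ∃ λ (ends : Fin n × Fin n) → ∀ {x z} → NonTreeEdge x z → x ≡ proj₁ ends ⊎ x ≡ proj₂ ends
    from-search (yes (a , b , ab)) = (a , b) , λ xz →
      Sum.map (λ same → sym (proj₁ same)) (λ swapped → sym (proj₂ swapped)) (nonTree-unique uni ab xz)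
    from-search (no none) = (r , r) , λ {x} {z} xz → ⊥-elim (none (x , z , xz))

  a b : Fin n
  a = proj₁ (proj₁ nonTree-ends)
  b = proj₂ (proj₁ nonTree-ends)

  TreeLeaf : Fin n → Set
  TreeLeaf v = v ≢ r × Childless v

  treeLeaf? : Decidable TreeLeaf
  treeLeaf? v = ¬? (v ≟F r) ×-dec ¬? (any? (isChild? v))

  leaves : List (Fin n)
  leaves = filter treeLeaf? (allFin n)

  treeLeaf-∈ : ∀ v → v ≢ r → treeLeaf v ∈ leaves
  treeLeaf-∈ v v≢r = ∈-filter⁺ treeLeaf? (∈-allFin _) (treeLeaf-≢root v v≢r , treeLeaf-childless v)

  K : ℕ
  K = suc (length leaves)

  classBy : ∀ v → Dec (v ≡ r) → Fin K
  classBy v (yes _) = zero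
  classBy v (no v≢r) = suc (index (treeLeaf-∈ v v≢r))

  class : Fin n → Fin K
  class v = classBy v (v ≟F r)

  class-root : class r ≡ zero
  class-root = root (r ≟F r)
    where
    root : (r≟r : Dec (r ≡ r)) → classBy r r≟r ≡ zero
    root (yes _) = refl
    root (no r≢r) = ⊥-elim (r≢r refl)

  class-zero : ∀ v → class v ≡ zero → v ≡ r
  class-zero v = zero-class (v ≟F r)
    where
    zero-class : (v≟r : Dec (v ≡ r)) → classBy v v≟r ≡ zero → v ≡ r
    zero-class (yes v≡r) _ = v≡r

  class-same-leaf : ∀ x y → x ≢ r → y ≢ r → class x ≡ class y → treeLeaf x ≡ treeLeaf y
  class-same-leaf x y x≢r y≢r = same-leaf (x ≟F r) (y ≟F r)
    where
    open ≡-Reasoning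
    same-leaf : (x≟r : Dec (x ≡ r)) (y≟r : Dec (y ≡ r)) → classBy x x≟r ≡ classBy y y≟r → treeLeaf x ≡ treeLeaf y
    same-leaf (yes x≡r) _ _ = ⊥-elim (x≢r x≡r)
    same-leaf (no _) (yes y≡r) _ = ⊥-elim (y≢r y≡r)
    same-leaf (no x≢r′) (no y≢r′) same = begin
      treeLeaf x                                  ≡⟨ lookup-index (treeLeaf-∈ x x≢r′) ⟩
      lookup leaves (index (treeLeaf-∈ x x≢r′))   ≡⟨ cong (lookup leaves) (fsuc-injective same) ⟩
      lookup leaves (index (treeLeaf-∈ y y≢r′))   ≡⟨ sym (lookup-index (treeLeaf-∈ y y≢r′)) ⟩
      treeLeaf y                                  ∎

  class-leaf : ∀ i → class (lookup leaves i) ≡ suc i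
  class-leaf i = leaf-class (L ≟F r)
    where
    L : Fin n
    L = lookup leaves i
    L-leaf : TreeLeaf L
    L-leaf = proj₂ (∈-filter⁻ treeLeaf? {xs = allFin n} (∈-lookup i))
    leaf-class : (L≟r : Dec (L ≡ r)) → classBy L L≟r ≡ suc i
    leaf-class (yes L≡r) = ⊥-elim (proj₁ L-leaf L≡r)
    leaf-class (no L≢r) = cong suc (lookup-injective (filter⁺ treeLeaf? (allFin⁺ n)) _ i
      (trans (sym (lookup-index (treeLeaf-∈ L L≢r))) (treeLeaf-self L (proj₂ L-leaf))))

  class-surjective : ∀ j → ∃ λ v → ∀ {z} → z ≡ v → class z ≡ j
  class-surjective zero = r , λ { refl → class-root }
  class-surjective (suc i) = lookup leaves i , λ { refl → class-leaf i }

  rootClass : Fin n → Bool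
  rootClass = classOf G class zero

  rootClass-nonroot : ∀ v → v ≢ r → rootClass v ≡ false
  rootClass-nonroot v v≢r = dec-false (class v ≟F zero) (λ cv≡0 → v≢r (class-zero v cv≡0))

  distSet-rootClass : ∀ x → distSet G x rootClass ≡ depth x
  distSet-rootClass x = attained-at-root (distSet-attained rootClass x r (dec-true (class r ≟F zero) class-root))
    where
    attained-at-root : (∃ λ w → rootClass w ≡ true × distSet G x rootClass ≡ d x w) → distSet G x rootClass ≡ depth x
    attained-at-root (w , w∈ , dxW≡dxw) =
      trans dxW≡dxw (trans (cong (d x) (class-zero w (≟-sound (class w) zero w∈))) (dist-sym x r))

  class-resolves : ∀ x y → x ≢ y → class x ≡ class y → ∃ λ j → StronglyResolves G (classOf G class j) x y
  class-resolves x y x≢y same =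
    zero , rootClass-nonroot x x≢r , rootClass-nonroot y y≢r ,
    resolved (same-treeLeaf-geodesic x y (class-same-leaf x y x≢r y≢r same))
    where
    x≢r : x ≢ r
    x≢r x≡r = x≢y (trans x≡r (sym (class-zero y (trans (sym same) (trans (cong class x≡r) class-root)))))
    y≢r : y ≢ r
    y≢r y≡r = x≢y (trans (class-zero x (trans same (trans (cong class y≡r) class-root))) (sym y≡r))
    resolved : depth x ≡ d x y + depth y ⊎ depth y ≡ d y x + depth x →
      distSet G x rootClass ≡ d x y + distSet G y rootClass ⊎ distSet G y rootClass ≡ d y x + distSet G x rootClass
    resolved (inj₁ y-between) rewrite distSet-rootClass x | distSet-rootClass y = inj₁ y-between
    resolved (inj₂ x-between) rewrite distSet-rootClass x | distSet-rootClass y = inj₂ x-between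

  EndNonRoot : Fin n → Set
  EndNonRoot v = EndVertex v × v ≢ r

  endNonRoot? : Decidable EndNonRoot
  endNonRoot? v = endVertex? v ×-dec ¬? (v ≟F r)

  NonTreeEnd : Fin n → Set
  NonTreeEnd v = v ≡ a ⊎ v ≡ b

  nonTreeEnd? : Decidable NonTreeEnd
  nonTreeEnd? v = (v ≟F a) ⊎-dec (v ≟F b)

  leaf-kinds : ∀ {v} → TreeLeaf v → EndNonRoot v ⊎ NonTreeEnd v
  leaf-kinds {v} (v≢r , childless) = Sum.map (_, v≢r) (λ nonTree → proj₂ nonTree-ends (proj₂ nonTree))
                                            (childless-kinds v v≢r childless)

  private
    #_ : ∀ {P : Pred (Fin n) lzero} → Decidable P → ℕ
    # P? = length (filter P? (allFin n))

  leaves-count : length leaves ≤ # endNonRoot? + 2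
  leaves-count = begin
    length leaves                          ≤⟨ filter-cover treeLeaf? endNonRoot? nonTreeEnd? leaf-kinds (allFin n) ⟩
    # endNonRoot? + # nonTreeEnd?          ≤⟨ +-monoʳ-≤ (# endNonRoot?) (filter-cover nonTreeEnd? (_≟F a) (_≟F b) (λ e → e) (allFin n)) ⟩
    # endNonRoot? + (# (_≟F a) + # (_≟F b))
                                           ≤⟨ +-monoʳ-≤ (# endNonRoot?) (+-mono-≤ (count-unique a (allFin n) (allFin⁺ n)) (count-unique b (allFin n) (allFin⁺ n))) ⟩
    # endNonRoot? + 2                      ∎
    where open ≤-Reasoning

  -- r is an end-vertex that is not a tree leaf, which saves one class.
  class-count : K ≤ numEndVertices G + 2
  class-count = begin
    suc (length leaves)                   ≤⟨ +-monoˡ-≤ (length leaves) (count-allFin r) ⟩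
    # (_≟F r) + length leaves             ≤⟨ +-monoʳ-≤ (# (_≟F r)) leaves-count ⟩
    # (_≟F r) + (# endNonRoot? + 2)       ≡⟨ sym (+-assoc (# (_≟F r)) _ 2) ⟩
    # (_≟F r) + # endNonRoot? + 2         ≡⟨ cong (_+ 2) (+-comm (# (_≟F r)) _) ⟩
    # endNonRoot? + # (_≟F r) + 2         ≤⟨ +-monoˡ-≤ 2 (filter-disjoint endNonRoot? endVertex? (_≟F r) proj₁ (λ { refl → end-r }) proj₂ (allFin n)) ⟩
    numEndVertices G + 2                  ∎
    where open ≤-Reasoning

upper-bound : ∀ {n} (G : Graph n) → Unicyclic G → ∀ r → Degrees.EndVertex G r →
  ∃ λ (k : ℕ) → ∃ λ (c : Fin n → Fin k) → IsStrongResolvingPartition G k c × k ≤ numEndVertices G + 2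
upper-bound G uni r end-r = K , class , (class-surjective , class-resolves) , class-count
  where open UpperBound G uni r end-r

-- The theorem.
theorem26 : ∀ {n : ℕ} (G : Graph n) →
    Unicyclic G → ¬ IsCycleGraph G → 2 ≤ numEndVertices G →
      (∃ λ (k : ℕ) → ∃ λ (c : Fin n → Fin k) →
          IsStrongResolvingPartition G k c × k ≤ numEndVertices G + 2)
    × (∀ (k : ℕ) (c : Fin n → Fin k) →
          IsStrongResolvingPartition G k c → numEndVertices G ≤ k)
theorem26 {n} G uni _ two-ends = bounds (filter-nonempty (Degrees.endVertex? G) (allFin n) (≤-trans (s≤s z≤n) two-ends))
  where
  bounds : ∃ (Degrees.EndVertex G) →
    (∃ λ (k : ℕ) → ∃ λ (c : Fin n → Fin k) → IsStrongResolvingPartition G k c × k ≤ numEndVertices G + 2)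
    × (∀ (k : ℕ) (c : Fin n → Fin k) → IsStrongResolvingPartition G k c → numEndVertices G ≤ k)
  bounds (r , end-r) = upper-bound G uni r end-r , LowerBound.lower-bound G (proj₁ uni)
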